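{- There exists a natural number $N$ such that every natural number $n \geq N$ can be written as $n = z + q$ where $z$ is a Zumkeller number and $q$ is a practical number.
   Context: A natural number $n$ is a Zumkeller number if the set of its positive divisors can be partitioned into two subsets with equal sums. A natural number $q$ is practical if every natural number less than or equal to $q$ can be written as a sum of distinct positive divisors of $q$ (so $1, 2, 4, 6, 8, 12, 16, \ldots$ are practical). -}

module Defs where

open import Data.Nat using (ℕ; zero; suc; _+_; _≤_; _≥_)
open import Data.Nat.Divisibility using (_∣_; _∣?_)
open import Data.List using (List; []; _∷_; filter; upTo; sum; length; map; drop)
open import Data.Bool using (Bool; true; false)
open import Data.Vec using (Vec; []; _∷_)
open import Data.Product using (Σ; ∃; _×_)
open import Relation.Binary.PropositionalEquality using (_≡_)

-- Positive divisors of n, listed in increasing order: all d with 1 ≤ d ≤ n and d ∣ n.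
-- (upTo (suc n) = [0 .. n]; drop 1 removes 0.)
divisors : ℕ → List ℕ
divisors n = filter (_∣? n) (drop 1 (upTo (suc n)))

chosenSum : (xs : List ℕ) → Vec Bool (length xs) → ℕ
chosenSum []       []            = 0
chosenSum (x ∷ xs) (true  ∷ bs)  = x + chosenSum xs bs
chosenSum (x ∷ xs) (false ∷ bs)  = chosenSum xs bs

unchosenSum : (xs : List ℕ) → Vec Bool (length xs) → ℕ
unchosenSum []       []            = 0
unchosenSum (x ∷ xs) (true  ∷ bs)  = unchosenSum xs bs
unchosenSum (x ∷ xs) (false ∷ bs)  = x + unchosenSum xs bs

-- Natural numbers are the positive integers.
-- n is Zumkeller: the set of positive divisors of n can be partitioned into two
-- subsets (chosen / not chosen) with equal sums.
Zumkeller : ℕ → Set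
Zumkeller n = 1 ≤ n × Σ (Vec Bool (length (divisors n)))
  (λ bs → chosenSum (divisors n) bs ≡ unchosenSum (divisors n) bs)

Practical : ℕ → Set
Practical q = 1 ≤ q × ((m : ℕ) → 1 ≤ m → m ≤ q →
  Σ (Vec Bool (length (divisors q))) (λ bs → chosenSum (divisors q) bs ≡ m))

-- Take z = 945 (1 + 945 J) and q = 2^20 t. A Zumkeller partition {S, S'} of the divisors of a
-- lifts to the partition {S W, S' W} of the divisors of a w whenever w is coprime to a (W the
-- divisors of w); as 945 is Zumkeller and coprime to 1 + 945 J, z is Zumkeller. For 1 ≤ t ≤ 2^(k+1),
-- every m ≤ 2^k t is b + t a with b < t and a ≤ 2^k, and the binary digits of b and a give distinct
-- divisors 2^i and t 2^j summing to m, so q is practical. Finally 2^20 is invertible modulo 945²,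
-- so for n large t ∈ [945², 2·945²) can be chosen with 2^20 t ≡ n − 945 (mod 945²).
module Submission where

open import Defs
open import Data.Bool using (Bool; true; false)
open import Data.List using (List; []; _∷_; _++_; map; filter; length; applyUpTo; cartesianProductWith)
open import Data.List.Membership.Propositional using (_∈_)
open import Data.List.Membership.Propositional.Properties
  using (∈-filter⁺; ∈-filter⁻; ∈-applyUpTo⁺; ∈-applyUpTo⁻; ∈-map⁻; ∈-++⁻; ∈-cartesianProductWith⁺; ∈-cartesianProductWith⁻)
open import Data.List.Membership.Propositional.Properties.WithK using (unique∧set⇒bag)
open import Data.List.Relation.Binary.BagAndSetEquality using (∼bag⇒↭)
open import Data.List.Relation.Binary.Subset.Propositional using (_⊆_)
open import Data.List.Relation.Unary.All as All using (All; []; _∷_)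
open import Data.List.Relation.Unary.Any using (here; there)
open import Data.List.Relation.Unary.AllPairs using ([]; _∷_)
open import Data.List.Relation.Unary.Unique.Propositional using (Unique)
import Data.List.Relation.Unary.Unique.Propositional.Properties as Unique
open import Data.Nat using (ℕ; zero; suc; _+_; _*_; _∸_; _^_; _≤_; _<_; _≥_; _≟_; _<?_; z≤n; s≤s; NonZero; ≢-nonZero; ≢-nonZero⁻¹; >-nonZero; >-nonZero⁻¹)
open import Data.List.Membership.DecPropositional _≟_ using (_∈?_)
open import Data.Nat.Divisibility
open import Data.Nat.DivMod using (_/_; _%_; m*[n/m]≡n; m%n<n; m*n/n≡m; /-monoˡ-≤; m≡m%n+[m/n]*n)
open import Data.Nat.GCD using (gcd; gcd[m,n]∣m; gcd[m,n]∣n; gcd[m,n]≢0)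
open import Data.Nat.Coprimality using (Coprime; coprime-divisor; coprime-/gcd)
open import Data.Nat.ListAction using (sum)
open import Data.Nat.ListAction.Properties using (sum-↭; sum-++)
open import Data.Nat.Properties
open import Data.Nat.Solver using (module +-*-Solver)
open import Algebra.Properties.CommutativeSemigroup +-commutativeSemigroup using (x∙yz≈y∙xz)
open import Data.Product using (Σ; ∃; ∃₂; _×_; _,_; proj₁; proj₂)
open import Data.Sum using (inj₁; inj₂)
open import Data.Empty using (⊥)
open import Data.Vec using (Vec; []; _∷_)
open import Function using (_∘_; id; _⇔_; mk⇔)
open import Relation.Nullary using (does; yes; no; contradiction)
open import Relation.Binary.PropositionalEquality

∈⇒≤sum : ∀ {v xs} → v ∈ xs → v ≤ sum xs
∈⇒≤sum {xs = x ∷ xs} (here refl) = m≤m+n x (sum xs)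
∈⇒≤sum {xs = x ∷ xs} (there v∈)  = ≤-trans (∈⇒≤sum v∈) (m≤n+m (sum xs) x)

sum-map-* : ∀ d es → sum (map (d *_) es) ≡ d * sum es
sum-map-* d []       = sym (*-zeroʳ d)
sum-map-* d (e ∷ es) = trans (cong (d * e +_) (sum-map-* d es)) (sym (*-distribˡ-+ d e (sum es)))

sum-cartesianProductWith-* : ∀ ds es → sum (cartesianProductWith _*_ ds es) ≡ sum ds * sum es
sum-cartesianProductWith-* []       es = refl
sum-cartesianProductWith-* (d ∷ ds) es = begin
  sum (map (d *_) es ++ cartesianProductWith _*_ ds es)       ≡⟨ sum-++ (map (d *_) es) _ ⟩
  sum (map (d *_) es) + sum (cartesianProductWith _*_ ds es) ≡⟨ cong₂ _+_ (sum-map-* d es) (sum-cartesianProductWith-* ds es) ⟩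
  d * sum es + sum ds * sum es                                ≡⟨ *-distribʳ-+ (sum es) d (sum ds) ⟨
  (d + sum ds) * sum es                                       ∎
  where open ≡-Reasoning

cartesianProductWith-*-unique : ∀ {ds es} → Unique ds → Unique es → All NonZero ds →
  (∀ {d₁ d₂ e₁ e₂} → d₁ ∈ ds → d₂ ∈ ds → e₁ ∈ es → e₂ ∈ es → d₁ * e₁ ≡ d₂ * e₂ → d₁ ≡ d₂) →
  Unique (cartesianProductWith _*_ ds es)
cartesianProductWith-*-unique {[]}     _            _   _            _   = []
cartesianProductWith-*-unique {d ∷ ds} {es} (d∉ds ∷ ds!) es! (d≢0 ∷ ds≢0) inj =
  Unique.++⁺ (Unique.map⁺ (*-cancelˡ-≡ _ _ d {{d≢0}}) es!)
             (cartesianProductWith-*-unique ds! es! ds≢0 (λ d₁∈ d₂∈ → inj (there d₁∈) (there d₂∈)))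
             disjoint
  where
  disjoint : ∀ {v} → v ∈ map (d *_) es × v ∈ cartesianProductWith _*_ ds es → ⊥
  disjoint (v∈des , v∈ds*es) with ∈-map⁻ (d *_) v∈des | ∈-cartesianProductWith⁻ _*_ ds es v∈ds*es
  ... | e , e∈es , refl | d′ , e′ , d′∈ds , e′∈es , de≡d′e′ =
    All.lookup d∉ds d′∈ds (inj (here refl) (there d′∈ds) e∈es e′∈es de≡d′e′)

sum-≡-unique : ∀ {xs ys} → Unique xs → Unique ys → (∀ {v} → v ∈ xs ⇔ v ∈ ys) → sum xs ≡ sum ys
sum-≡-unique xs! ys! xs⇔ys = sum-↭ (∼bag⇒↭ (unique∧set⇒bag xs! ys! xs⇔ys))

chosenSum+unchosenSum≡sum : ∀ xs (bs : Vec Bool (length xs)) →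
  chosenSum xs bs + unchosenSum xs bs ≡ sum xs
chosenSum+unchosenSum≡sum []       []           = refl
chosenSum+unchosenSum≡sum (x ∷ xs) (true  ∷ bs) =
  trans (+-assoc x _ _) (cong (x +_) (chosenSum+unchosenSum≡sum xs bs))
chosenSum+unchosenSum≡sum (x ∷ xs) (false ∷ bs) =
  trans (x∙yz≈y∙xz (chosenSum xs bs) x _) (cong (x +_) (chosenSum+unchosenSum≡sum xs bs))

chosen : (xs : List ℕ) → Vec Bool (length xs) → List ℕ
chosen []       []           = []
chosen (x ∷ xs) (true  ∷ bs) = x ∷ chosen xs bs
chosen (x ∷ xs) (false ∷ bs) = chosen xs bs

sum-chosen : ∀ xs bs → sum (chosen xs bs) ≡ chosenSum xs bs
sum-chosen []       []           = refl
sum-chosen (x ∷ xs) (true  ∷ bs) = cong (x +_) (sum-chosen xs bs)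
sum-chosen (x ∷ xs) (false ∷ bs) = sum-chosen xs bs

chosen-⊆ : ∀ xs bs → chosen xs bs ⊆ xs
chosen-⊆ []       []           ()
chosen-⊆ (x ∷ xs) (true  ∷ bs) (here v≡x)   = here v≡x
chosen-⊆ (x ∷ xs) (true  ∷ bs) (there v∈cs) = there (chosen-⊆ xs bs v∈cs)
chosen-⊆ (x ∷ xs) (false ∷ bs) v∈cs         = there (chosen-⊆ xs bs v∈cs)

chosen-unique : ∀ {xs} bs → Unique xs → Unique (chosen xs bs)
chosen-unique {[]}     []           _           = []
chosen-unique {x ∷ xs} (true  ∷ bs) (x∉xs ∷ u) =
  All.tabulate (All.lookup x∉xs ∘ chosen-⊆ xs bs) ∷ chosen-unique bs u
chosen-unique {x ∷ xs} (false ∷ bs) (_    ∷ u) = chosen-unique bs u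

select : List ℕ → (xs : List ℕ) → Vec Bool (length xs)
select ys []       = []
select ys (x ∷ xs) = does (x ∈? ys) ∷ select ys xs

chosen-select : ∀ ys xs → chosen xs (select ys xs) ≡ filter (_∈? ys) xs
chosen-select ys []       = refl
chosen-select ys (x ∷ xs) with x ∈? ys
... | yes _ = cong (x ∷_) (chosen-select ys xs)
... | no  _ = chosen-select ys xs

chosenSum-⊆ : ∀ {xs ys} → Unique xs → Unique ys → ys ⊆ xs →
  Σ (Vec Bool (length xs)) (λ bs → chosenSum xs bs ≡ sum ys)
chosenSum-⊆ {xs} {ys} xs! ys! ys⊆xs = select ys xs , (begin
  chosenSum xs (select ys xs)     ≡⟨ sum-chosen xs (select ys xs) ⟨
  sum (chosen xs (select ys xs))  ≡⟨ cong sum (chosen-select ys xs) ⟩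
  sum (filter (_∈? ys) xs)        ≡⟨ sum-≡-unique (Unique.filter⁺ (_∈? ys) xs!) ys! filter⇔ys ⟩
  sum ys                          ∎)
  where
  open ≡-Reasoning
  filter⇔ys : ∀ {v} → v ∈ filter (_∈? ys) xs ⇔ v ∈ ys
  filter⇔ys = mk⇔ (proj₂ ∘ ∈-filter⁻ (_∈? ys) {xs = xs}) (λ v∈ys → ∈-filter⁺ (_∈? ys) (ys⊆xs v∈ys) v∈ys)

σ : ℕ → ℕ
σ n = sum (divisors n)

divisors-unique : ∀ n → Unique (divisors n)
divisors-unique n = Unique.filter⁺ (_∣? n) (Unique.drop⁺ 1 (Unique.upTo⁺ (suc n)))

∈-divisors⁺ : ∀ {n d} .{{_ : NonZero n}} → d ∣ n → d ∈ divisors n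
∈-divisors⁺ {suc n} {zero}  0∣n = contradiction (0∣⇒≡0 0∣n) λ ()
∈-divisors⁺ {suc n} {suc d} d∣n =
  ∈-filter⁺ (_∣? suc n) {xs = applyUpTo suc (suc n)} (∈-applyUpTo⁺ suc (∣⇒≤ d∣n)) d∣n

∈-divisors⁻ : ∀ n {d} → d ∈ divisors n → d ∣ n × NonZero d
∈-divisors⁻ n d∈ with ∈-filter⁻ (_∣? n) {xs = applyUpTo suc n} d∈
... | d∈range , d∣n with ∈-applyUpTo⁻ suc d∈range
...   | _ , _ , refl = d∣n , _

^-monoʳ-∣ : ∀ m {i k} → i ≤ k → m ^ i ∣ m ^ k
^-monoʳ-∣ m {i} {k} i≤k = divides (m ^ (k ∸ i)) (begin
  m ^ k                ≡⟨ cong (m ^_) (m+[n∸m]≡n i≤k) ⟨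
  m ^ (i + (k ∸ i))    ≡⟨ ^-distribˡ-+-* m i (k ∸ i) ⟩
  m ^ i * m ^ (k ∸ i)  ≡⟨ *-comm (m ^ i) _ ⟩
  m ^ (k ∸ i) * m ^ i  ∎)
  where open ≡-Reasoning

HalvingSet : ℕ → List ℕ → Set
HalvingSet n S = Unique S × S ⊆ divisors n × sum S + sum S ≡ σ n

zumkeller⇒halvingSet : ∀ {n} → Zumkeller n → ∃ (HalvingSet n)
zumkeller⇒halvingSet {n} (_ , bs , c≡u) =
  chosen (divisors n) bs ,
  chosen-unique bs (divisors-unique n) ,
  chosen-⊆ (divisors n) bs ,
  (begin
    sum S + sum S                                           ≡⟨ cong (λ s → s + s) (sum-chosen (divisors n) bs) ⟩
    chosenSum (divisors n) bs + chosenSum (divisors n) bs   ≡⟨ cong (chosenSum (divisors n) bs +_) c≡u ⟩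
    chosenSum (divisors n) bs + unchosenSum (divisors n) bs ≡⟨ chosenSum+unchosenSum≡sum (divisors n) bs ⟩
    σ n                                                     ∎)
  where
  open ≡-Reasoning
  S = chosen (divisors n) bs

halvingSet⇒zumkeller : ∀ {n S} → 1 ≤ n → HalvingSet n S → Zumkeller n
halvingSet⇒zumkeller {n} {S} 1≤n (S! , S⊆ , S+S≡σ) with chosenSum-⊆ (divisors-unique n) S! S⊆
... | bs , c≡S = 1≤n , bs , trans c≡S (sym u≡S)
  where
  u≡S : unchosenSum (divisors n) bs ≡ sum S
  u≡S = +-cancelˡ-≡ (sum S) _ _ (begin
    sum S + unchosenSum (divisors n) bs                     ≡⟨ cong (_+ _) c≡S ⟨
    chosenSum (divisors n) bs + unchosenSum (divisors n) bs ≡⟨ chosenSum+unchosenSum≡sum (divisors n) bs ⟩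
    σ n                                                     ≡⟨ S+S≡σ ⟨
    sum S + sum S                                           ∎)
    where open ≡-Reasoning

module _ {a w : ℕ} .{{_ : NonZero a}} .{{_ : NonZero w}} (a⊥w : Coprime a w) where

  coprime-divisors-*-injectiveˡ : ∀ {d₁ d₂ e₁ e₂} → d₁ ∣ a → d₂ ∣ a → e₁ ∣ w → e₂ ∣ w →
    d₁ * e₁ ≡ d₂ * e₂ → d₁ ≡ d₂
  coprime-divisors-*-injectiveˡ d₁∣a d₂∣a e₁∣w e₂∣w eq =
    ∣-antisym (divides-other d₁∣a e₂∣w eq) (divides-other d₂∣a e₁∣w (sym eq))
    where
    divides-other : ∀ {x y u v} → x ∣ a → v ∣ w → x * u ≡ y * v → x ∣ y
    divides-other {x} {y} {u} {v} x∣a v∣w xu≡yv = coprime-divisor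
      (λ (i∣x , i∣v) → a⊥w (∣-trans i∣x x∣a , ∣-trans i∣v v∣w))
      (subst (x ∣_) (trans xu≡yv (*-comm y v)) (m∣m*n u))

  divisor-of-coprime-* : ∀ {y} → y ∣ a * w → ∃₂ λ d e → d ∣ a × e ∣ w × y ≡ d * e
  divisor-of-coprime-* {y} y∣aw = g , y / g , gcd[m,n]∣n y a , e∣w , sym g*e≡y
    where
    g = gcd y a
    instance
      g≢0 : NonZero g
      g≢0 = ≢-nonZero (gcd[m,n]≢0 y a (inj₂ (≢-nonZero⁻¹ a)))
    g*e≡y : g * (y / g) ≡ y
    g*e≡y = m*[n/m]≡n (gcd[m,n]∣m y a)
    g*f≡a : g * (a / g) ≡ a
    g*f≡a = m*[n/m]≡n (gcd[m,n]∣n y a)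
    e∣f*w : y / g ∣ (a / g) * w
    e∣f*w = *-cancelˡ-∣ g (subst₂ _∣_ (sym g*e≡y)
      (trans (cong (_* w) (sym g*f≡a)) (*-assoc g (a / g) w)) y∣aw)
    e∣w : y / g ∣ w
    e∣w = coprime-divisor (coprime-/gcd y a) e∣f*w

  divisors-*-⊆ : divisors (a * w) ⊆ cartesianProductWith _*_ (divisors a) (divisors w)
  divisors-*-⊆ y∈ with divisor-of-coprime-* (proj₁ (∈-divisors⁻ (a * w) y∈))
  ... | d , e , d∣a , e∣w , refl = ∈-cartesianProductWith⁺ _*_ (∈-divisors⁺ d∣a) (∈-divisors⁺ e∣w)

  module _ {S : List ℕ} (S⊆ : S ⊆ divisors a) where

    cartesianProductWith-*-divisors-⊆ : cartesianProductWith _*_ S (divisors w) ⊆ divisors (a * w)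
    cartesianProductWith-*-divisors-⊆ v∈ with ∈-cartesianProductWith⁻ _*_ S (divisors w) v∈
    ... | d , e , d∈S , e∈W , refl = ∈-divisors⁺ {{m*n≢0 a w}}
      (*-pres-∣ (proj₁ (∈-divisors⁻ a (S⊆ d∈S))) (proj₁ (∈-divisors⁻ w e∈W)))

    cartesianProductWith-*-divisors-unique : Unique S → Unique (cartesianProductWith _*_ S (divisors w))
    cartesianProductWith-*-divisors-unique S! =
      cartesianProductWith-*-unique S! (divisors-unique w) (All.tabulate (proj₂ ∘ ∈-divisors⁻ a ∘ S⊆))
        λ d₁∈ d₂∈ e₁∈ e₂∈ → coprime-divisors-*-injectiveˡ
          (proj₁ (∈-divisors⁻ a (S⊆ d₁∈))) (proj₁ (∈-divisors⁻ a (S⊆ d₂∈)))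
          (proj₁ (∈-divisors⁻ w e₁∈)) (proj₁ (∈-divisors⁻ w e₂∈))

  σ-* : σ (a * w) ≡ σ a * σ w
  σ-* = trans
    (sum-≡-unique (divisors-unique (a * w)) (cartesianProductWith-*-divisors-unique id (divisors-unique a))
      (mk⇔ divisors-*-⊆ (cartesianProductWith-*-divisors-⊆ id)))
    (sum-cartesianProductWith-* (divisors a) (divisors w))

  zumkeller-* : Zumkeller a → Zumkeller (a * w)
  zumkeller-* za with zumkeller⇒halvingSet za
  ... | S , S! , S⊆ , S+S≡σa = halvingSet⇒zumkeller (>-nonZero⁻¹ (a * w) {{m*n≢0 a w}})
    (cartesianProductWith-*-divisors-unique S⊆ S! , cartesianProductWith-*-divisors-⊆ S⊆ , (begin
      sum T + sum T              ≡⟨ cong (λ s → s + s) (sum-cartesianProductWith-* S (divisors w)) ⟩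
      sum S * σ w + sum S * σ w  ≡⟨ *-distribʳ-+ (σ w) (sum S) (sum S) ⟨
      (sum S + sum S) * σ w      ≡⟨ cong (_* σ w) S+S≡σa ⟩
      σ a * σ w                  ≡⟨ σ-* ⟨
      σ (a * w)                  ∎))
    where
    open ≡-Reasoning
    T = cartesianProductWith _*_ S (divisors w)

coprime-1+n*k : ∀ n k → Coprime n (1 + n * k)
coprime-1+n*k n k {i} (i∣n , i∣1+nk) =
  ∣1⇒≡1 (∣m+n∣m⇒∣n (subst (i ∣_) (+-comm 1 (n * k)) i∣1+nk) (∣-trans i∣n (m∣m*n k)))

-- The halves are {15, 945} and the remaining fourteen divisors, each summing to 960.
zumkeller-945 : Zumkeller 945
zumkeller-945 = s≤s z≤n , halves , refl
  where
  halves : Vec Bool 16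
  halves = false ∷ false ∷ false ∷ false ∷ false ∷ true ∷ false ∷ false ∷
           false ∷ false ∷ false ∷ false ∷ false ∷ false ∷ false ∷ true ∷ []

zumkeller-*[1+*] : ∀ {a} k → Zumkeller a → Zumkeller (a * (1 + a * k))
zumkeller-*[1+*] {a} k za@(1≤a , _) =
  zumkeller-* {a = a} {w = 1 + a * k} {{>-nonZero 1≤a}} (coprime-1+n*k a k) za

binary : ℕ → ℕ → List ℕ
binary zero    b = []
binary (suc k) b with b <? 2 ^ k
... | yes _ = binary k b
... | no  _ = 2 ^ k ∷ binary k (b ∸ 2 ^ k)

sum-binary : ∀ k {b} → b < 2 ^ k → sum (binary k b) ≡ b
sum-binary zero    {zero}  _          = refl
sum-binary zero    {suc b} (s≤s ())
sum-binary (suc k) {b}     b<2^[1+k] with b <? 2 ^ k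
... | yes b<2^k = sum-binary k b<2^k
... | no  b≮2^k = trans (cong (2 ^ k +_) (sum-binary k b∸2^k<2^k)) (m+[n∸m]≡n (≮⇒≥ b≮2^k))
  where
  b∸2^k<2^k : b ∸ 2 ^ k < 2 ^ k
  b∸2^k<2^k = subst (b ∸ 2 ^ k <_) (trans (m+n∸m≡n (2 ^ k) _) (+-identityʳ (2 ^ k)))
    (∸-monoˡ-< b<2^[1+k] (≮⇒≥ b≮2^k))

∈-binary⁻ : ∀ k {b v} → v ∈ binary k b → ∃ λ i → i < k × v ≡ 2 ^ i
∈-binary⁻ (suc k) {b} v∈ with b <? 2 ^ k
... | yes _ = let i , i<k , v≡2^i = ∈-binary⁻ k v∈ in i , m<n⇒m<1+n i<k , v≡2^i
∈-binary⁻ (suc k) {b} (here v≡2^k) | no _ = k , n<1+n k , v≡2^k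
∈-binary⁻ (suc k) {b} (there v∈)   | no _ = let i , i<k , v≡2^i = ∈-binary⁻ k v∈ in i , m<n⇒m<1+n i<k , v≡2^i

binary-unique : ∀ k b → Unique (binary k b)
binary-unique zero    b = []
binary-unique (suc k) b with b <? 2 ^ k
... | yes _ = binary-unique k b
... | no  _ = All.tabulate 2^k∉ ∷ binary-unique k (b ∸ 2 ^ k)
  where
  2^k∉ : ∀ {v} → v ∈ binary k (b ∸ 2 ^ k) → 2 ^ k ≢ v
  2^k∉ v∈ with ∈-binary⁻ k v∈
  ... | i , i<k , refl = >⇒≢ (^-monoʳ-< 2 (s≤s (s≤s z≤n)) i<k)

∈-binary⇒∣ : ∀ k {b v} → v ∈ binary (suc k) b → v ∣ 2 ^ k
∈-binary⇒∣ k v∈ with ∈-binary⁻ (suc k) v∈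
... | i , s≤s i≤k , refl = ^-monoʳ-∣ 2 i≤k

SumOfDistinctDivisors : ℕ → ℕ → List ℕ → Set
SumOfDistinctDivisors q m ys = Unique ys × ys ⊆ divisors q × sum ys ≡ m

sumsOfDistinctDivisors⇒practical : ∀ {q} → 1 ≤ q →
  (∀ m → m ≤ q → ∃ (SumOfDistinctDivisors q m)) → Practical q
sumsOfDistinctDivisors⇒practical {q} 1≤q represent = 1≤q , λ m _ m≤q → chosenSum≡ (represent m m≤q)
  where
  chosenSum≡ : ∀ {m} → ∃ (SumOfDistinctDivisors q m) →
    Σ (Vec Bool (length (divisors q))) (λ bs → chosenSum (divisors q) bs ≡ m)
  chosenSum≡ (ys , ys! , ys⊆ , Σys≡m) with chosenSum-⊆ (divisors-unique q) ys! ys⊆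
  ... | bs , bs≡Σys = bs , trans bs≡Σys Σys≡m

-- The digits 2^i of b are distinct from the t 2^j because 2^i ≤ b < t.
binary-sumOfDistinctDivisors : ∀ k {t a b} .{{_ : NonZero t}} → b < t → t ≤ 2 ^ suc k → a < 2 ^ suc k →
  SumOfDistinctDivisors (2 ^ k * t) (b + t * a) (binary (suc k) b ++ map (t *_) (binary (suc k) a))
binary-sumOfDistinctDivisors k {t} {a} {b} b<t t≤2^[1+k] a<2^[1+k] = ys! , ys⊆ , Σys≡b+ta
  where
  instance
    q≢0 : NonZero (2 ^ k * t)
    q≢0 = m*n≢0 (2 ^ k) t {{m^n≢0 2 k}}
  low = binary (suc k) b
  high = map (t *_) (binary (suc k) a)

  Σlow≡b : sum low ≡ b
  Σlow≡b = sum-binary (suc k) (<-≤-trans b<t t≤2^[1+k])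

  low<t : ∀ {v} → v ∈ low → v < t
  low<t v∈ = ≤-<-trans (subst (_ ≤_) Σlow≡b (∈⇒≤sum v∈)) b<t

  t≤high : ∀ {v} → v ∈ high → t ≤ v
  t≤high v∈ with ∈-map⁻ (t *_) v∈
  ... | x , x∈ , refl with ∈-binary⁻ (suc k) x∈
  ...   | i , _ , refl = m≤m*n t (2 ^ i) {{m^n≢0 2 i}}

  ys! : Unique (low ++ high)
  ys! = Unique.++⁺ (binary-unique (suc k) b) (Unique.map⁺ (*-cancelˡ-≡ _ _ t) (binary-unique (suc k) a))
    λ (v∈low , v∈high) → <⇒≱ (low<t v∈low) (t≤high v∈high)

  ys⊆ : low ++ high ⊆ divisors (2 ^ k * t)
  ys⊆ v∈ with ∈-++⁻ low v∈
  ... | inj₁ v∈low = ∈-divisors⁺ (∣-trans (∈-binary⇒∣ k v∈low) (m∣m*n t))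
  ... | inj₂ v∈high with ∈-map⁻ (t *_) v∈high
  ...   | x , x∈ , refl = ∈-divisors⁺ (subst (t * x ∣_) (*-comm t (2 ^ k)) (*-monoʳ-∣ t (∈-binary⇒∣ k x∈)))

  Σys≡b+ta : sum (low ++ high) ≡ b + t * a
  Σys≡b+ta = trans (sum-++ low high)
    (cong₂ _+_ Σlow≡b (trans (sum-map-* t (binary (suc k) a)) (cong (t *_) (sum-binary (suc k) a<2^[1+k]))))

practical-2^k* : ∀ k {t} → 1 ≤ t → t ≤ 2 ^ suc k → Practical (2 ^ k * t)
practical-2^k* k {t} 1≤t t≤2^[1+k] = sumsOfDistinctDivisors⇒practical (*-mono-≤ (m^n>0 2 k) 1≤t)
  λ m m≤q → digits m , subst (λ n → SumOfDistinctDivisors (2 ^ k * t) n (digits m)) (m%t+t*[m/t]≡m m)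
    (binary-sumOfDistinctDivisors k (m%n<n m t) t≤2^[1+k] (m/t<2^[1+k] m m≤q))
  where
  instance
    t≢0 : NonZero t
    t≢0 = >-nonZero 1≤t
  digits : ℕ → List ℕ
  digits m = binary (suc k) (m % t) ++ map (t *_) (binary (suc k) (m / t))
  m%t+t*[m/t]≡m : ∀ m → m % t + t * (m / t) ≡ m
  m%t+t*[m/t]≡m m = trans (cong (m % t +_) (*-comm t (m / t))) (sym (m≡m%n+[m/n]*n m t))
  m/t<2^[1+k] : ∀ m → m ≤ 2 ^ k * t → m / t < 2 ^ suc k
  m/t<2^[1+k] m m≤q = ≤-<-trans (subst (m / t ≤_) (m*n/n≡m (2 ^ k) t) (/-monoˡ-≤ t m≤q))
    (^-monoʳ-< 2 (s≤s (s≤s z≤n)) (n<1+n k))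

m+n*x≡r+n*y⇒r≡m+n*[x∸y] : ∀ m n x r y → m + n * x ≡ r + n * y → m ≤ r → r ≡ m + n * (x ∸ y)
m+n*x≡r+n*y⇒r≡m+n*[x∸y] m n x r y eq m≤r = begin
  r                            ≡⟨ m+[n∸m]≡n m≤r ⟨
  m + (r ∸ m)                  ≡⟨ cong (m +_) (m+n∸n≡m (r ∸ m) (n * y)) ⟨
  m + (r ∸ m + n * y ∸ n * y)  ≡⟨ cong (λ s → m + (s ∸ n * y)) nx≡[r∸m]+ny ⟨
  m + (n * x ∸ n * y)          ≡⟨ cong (m +_) (*-distribˡ-∸ n x y) ⟨
  m + n * (x ∸ y)              ∎
  where
  open ≡-Reasoning
  nx≡[r∸m]+ny : n * x ≡ r ∸ m + n * y
  nx≡[r∸m]+ny = +-cancelˡ-≡ m _ _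
    (trans eq (trans (cong (_+ n * y) (sym (m+[n∸m]≡n m≤r))) (+-assoc m (r ∸ m) (n * y))))

-- With c an inverse of P modulo M, t = M + (r c mod M) satisfies P t ≡ r modulo M.
P*t+M*J-representation : ∀ P M c h .{{_ : NonZero M}} → P * c ≡ 1 + M * h →
  ∀ r → P * (2 * M) ≤ r → ∃₂ λ t J → M ≤ t × t < 2 * M × r ≡ P * t + M * J
P*t+M*J-representation P M c h Pc≡1+Mh r P2M≤r =
  t , P * s ∸ (r * h + P) , m≤m+n M v , t<2M ,
  m+n*x≡r+n*y⇒r≡m+n*[x∸y] (P * t) M (P * s) r (r * h + P) Pt+MPs≡r+M[rh+P]
    (≤-trans (*-monoʳ-≤ P (<⇒≤ t<2M)) P2M≤r)
  where
  v = (r * c) % M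
  s = (r * c) / M
  t = M + v

  t<2M : t < 2 * M
  t<2M = subst (t <_) (cong (M +_) (sym (+-identityʳ M))) (+-monoʳ-< M (m%n<n (r * c) M))

  open +-*-Solver
  Pt+MPs≡r+M[rh+P] : P * t + M * (P * s) ≡ r + M * (r * h + P)
  Pt+MPs≡r+M[rh+P] = begin
    P * (M + v) + M * (P * s)  ≡⟨ solve 4 (λ P M v s → P :* (M :+ v) :+ M :* (P :* s) := P :* M :+ P :* (v :+ s :* M)) refl P M v s ⟩
    P * M + P * (v + s * M)    ≡⟨ cong (λ x → P * M + P * x) (m≡m%n+[m/n]*n (r * c) M) ⟨
    P * M + P * (r * c)        ≡⟨ solve 4 (λ P M r c → P :* M :+ P :* (r :* c) := P :* M :+ r :* (P :* c)) refl P M r c ⟩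
    P * M + r * (P * c)        ≡⟨ cong (λ x → P * M + r * x) Pc≡1+Mh ⟩
    P * M + r * (1 + M * h)    ≡⟨ solve 4 (λ P M r h → P :* M :+ r :* (con 1 :+ M :* h) := r :+ M :* (r :* h :+ P)) refl P M r h ⟩
    r + M * (r * h + P)        ∎
    where open ≡-Reasoning

zumkeller+practical : ∀ {a} k c h → Zumkeller a → 2 ^ k * c ≡ 1 + a * a * h → a * a ≤ 2 ^ k →
  (n : ℕ) → n ≥ a + 2 ^ k * (2 * (a * a)) →
  Σ ℕ (λ z → Σ ℕ (λ q → Zumkeller z × Practical q × n ≡ z + q))
zumkeller+practical {a} k c h za@(1≤a , _) Pc≡1+a²h a²≤2^k n n≥N
  with P*t+M*J-representation (2 ^ k) (a * a) c h {{a²≢0}} Pc≡1+a²h (n ∸ a)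
         (subst (_≤ n ∸ a) (m+n∸m≡n a _) (∸-monoˡ-≤ a n≥N))
  where
  a²≢0 : NonZero (a * a)
  a²≢0 = m*n≢0 a a {{>-nonZero 1≤a}} {{>-nonZero 1≤a}}
... | t , J , a²≤t , t<2a² , n∸a≡ =
  a * (1 + a * J) , 2 ^ k * t ,
  zumkeller-*[1+*] J za ,
  practical-2^k* k (≤-trans (*-mono-≤ 1≤a 1≤a) a²≤t) (≤-trans (<⇒≤ t<2a²) (*-monoʳ-≤ 2 a²≤2^k)) ,
  (begin
    n                               ≡⟨ m+[n∸m]≡n (≤-trans (m≤m+n a _) n≥N) ⟨
    a + (n ∸ a)                     ≡⟨ cong (a +_) n∸a≡ ⟩
    a + (2 ^ k * t + a * a * J)     ≡⟨ solve 3 (λ a q J → a :+ (q :+ a :* a :* J) := a :* (con 1 :+ a :* J) :+ q) refl a (2 ^ k * t) J ⟩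
    a * (1 + a * J) + 2 ^ k * t     ∎)
  where
  open ≡-Reasoning
  open +-*-Solver

-- 166651 is the inverse of 2^20 modulo 945².
proposition4p10 : Σ ℕ (λ N → (n : ℕ) → n ≥ N →
    Σ ℕ (λ z → Σ ℕ (λ q → Zumkeller z × Practical q × n ≡ z + q)))
proposition4p10 =
  _ , zumkeller+practical 20 166651 195679 zumkeller-945 refl (≤ᵇ⇒≤ (945 * 945) (2 ^ 20) _)
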